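{- Let $K=\mathbb Q(\zeta_5)\subseteq\mathbb C$ with $\zeta_5=\exp(2\pi i/5)$, let $\mathcal O_K$ be its ring of integers, and let $\sigma:K\hookrightarrow\mathbb C$ be the embedding with $\sigma(\zeta_5)=\zeta_5^2$; write $z^{\sigma}=\sigma(z)$. Let $\mathcal S=\{z\in\mathcal O_K : |z^{\sigma}|\leq 1\}$. If $z_1,z_2\in\mathcal S$ with $z_1\neq z_2$ and $|z_1-z_2|<\frac{\sqrt5}{2}$, then $z_1-z_2$ is a unit of $\mathcal O_K$.
   Context: Elements of $K$ are regarded as complex numbers via the inclusion $K\subseteq\mathbb C$, and $|\cdot|$ is the complex absolute value. -}

module Defs where

open import Data.Integer using (ℤ; _+_; _-_; _*_; -_; _<_; _≤_; +_; 0ℤ; 1ℤ)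
open import Data.Product using (_×_; Σ)
open import Data.Sum using (_⊎_)
open import Relation.Binary.PropositionalEquality using (_≡_)

-- O_K = ℤ[ζ₅], ζ = ζ₅ = exp(2πi/5).  An element is a0 + a1 ζ + a2 ζ² + a3 ζ³
-- (integral basis 1, ζ, ζ², ζ³; minimal polynomial ζ⁴+ζ³+ζ²+ζ+1).
record Zζ : Set where
  constructor ⟨_,_,_,_⟩
  field
    c0 c1 c2 c3 : ℤ

-- the element d0 + d1 ζ + d2 ζ² + d3 ζ³ + d4 ζ⁴, using ζ⁴ = -1-ζ-ζ²-ζ³
red5 : ℤ → ℤ → ℤ → ℤ → ℤ → Zζ
red5 d0 d1 d2 d3 d4 = ⟨ d0 - d4 , d1 - d4 , d2 - d4 , d3 - d4 ⟩

oneζ : Zζ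
oneζ = ⟨ 1ℤ , 0ℤ , 0ℤ , 0ℤ ⟩

_-ζ_ : Zζ → Zζ → Zζ
⟨ a0 , a1 , a2 , a3 ⟩ -ζ ⟨ b0 , b1 , b2 , b3 ⟩ = ⟨ a0 - b0 , a1 - b1 , a2 - b2 , a3 - b3 ⟩

-- multiplication, using ζ⁵ = 1 and then ζ⁴ = -1-ζ-ζ²-ζ³
_*ζ_ : Zζ → Zζ → Zζ
⟨ a0 , a1 , a2 , a3 ⟩ *ζ ⟨ b0 , b1 , b2 , b3 ⟩ =
  red5 (a0 * b0 + (a2 * b3 + a3 * b2))
       (a0 * b1 + a1 * b0 + a3 * b3)
       (a0 * b2 + a1 * b1 + a2 * b0)
       (a0 * b3 + a1 * b2 + a2 * b1 + a3 * b0)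
       (a1 * b3 + a2 * b2 + a3 * b1)

-- complex conjugation: ζ ↦ ζ⁴ = ζ⁻¹
conj : Zζ → Zζ
conj ⟨ a0 , a1 , a2 , a3 ⟩ = red5 a0 0ℤ a3 a2 a1

-- the embedding σ with σ(ζ) = ζ²
σ : Zζ → Zζ
σ ⟨ a0 , a1 , a2 , a3 ⟩ = red5 a0 a3 a1 0ℤ a2

IsUnit : Zζ → Set
IsUnit z = Σ Zζ (λ w → z *ζ w ≡ oneζ)

-- Real numbers of the form a + b√5 (a b ∈ ℤ), with the order of ℝ.
record QS : Set where
  constructor _+√5·_
  field
    ra rb : ℤ

-- a + b√5 > 0 (as a real number), decided by integer arithmetic
Pos : QS → Set
Pos (a +√5· b) =
    (0ℤ < a × 0ℤ ≤ b)
  ⊎ (0ℤ ≤ a × 0ℤ < b)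
  ⊎ (0ℤ < a × (b < 0ℤ × (+ 5) * (b * b) < a * a))
  ⊎ (a < 0ℤ × (0ℤ < b × a * a < (+ 5) * (b * b)))

NonNeg : QS → Set
NonNeg x = Pos x ⊎ (QS.ra x ≡ 0ℤ × QS.rb x ≡ 0ℤ)

_⊖_ : ℤ → QS → QS
c ⊖ (a +√5· b) = (c - a) +√5· (- b)

-- 4·Re(z): Re ζ = (√5-1)/4, Re ζ² = Re ζ³ = -(√5+1)/4
fourRe : Zζ → QS
fourRe ⟨ a0 , a1 , a2 , a3 ⟩ =
  ((+ 4) * a0 - a1 - a2 - a3) +√5· (a1 - a2 - a3)

fourAbsSq : Zζ → QS
fourAbsSq z = fourRe (z *ζ conj z)

InS : Zζ → Set
InS z = NonNeg ((+ 4) ⊖ fourAbsSq (σ z))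

AbsLtHalfSqrt5 : Zζ → Set
AbsLtHalfSqrt5 z = Pos ((+ 5) ⊖ fourAbsSq z)

{-# OPTIONS --safe #-}
-- Let w = z₁ − z₂ and write 4|w|² = A + B√5 with A, B ∈ ℤ. The embedding σ acts on ℚ(√5) as
-- √5 ↦ −√5, so 4|σ w|² = A − B√5; and σ z₁, σ z₂ lie in the closed unit disc, so |σ w| ≤ 2 by the
-- parallelogram law. Adding 4|w|² < 5 and 4|σ w|² ≤ 16 gives 2A < 21, i.e. A ≤ 10. Since
-- A = Σ aᵢ² + Σ_{i<j} (aᵢ − aⱼ)² in the coordinates of w, all of them lie in [−3, 3], and a finite
-- check over these 7⁴ elements shows that every nonzero w with A ≤ 10 and 4|w|² < 5 has norm 1.
module Submission where

open import Defs
open import Data.Integer hiding (_⊖_; suc)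
open import Data.Integer.Properties
open import Data.Integer.Tactic.RingSolver using (solve-∀; solve)
open import Data.List using (List; []; _∷_; cartesianProduct; cartesianProductWith)
open import Data.List.Membership.Propositional using (_∈_)
open import Data.List.Membership.Propositional.Properties using (∈-cartesianProduct⁺; ∈-cartesianProductWith⁺)
open import Data.List.Relation.Unary.All using (All; all?; lookup)
open import Data.List.Relation.Unary.Any using (here; there)
open import Data.Nat using (suc; z≤n; s≤s)
open import Data.Product using (_×_; _,_)
open import Data.Sum using (_⊎_; inj₁; inj₂)
open import Function using (_∘_)
open import Relation.Binary.Definitions using (DecidableEquality)
open import Relation.Binary.PropositionalEquality
open import Relation.Nullary using (¬_; Dec; yes; no; contradiction)
open import Relation.Nullary.Decidable using (_×-dec_; _⊎-dec_; _→-dec_; ¬?; map′; from-yes; from-no)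

0≤-* : ∀ {i j} → 0ℤ ≤ i → 0ℤ ≤ j → 0ℤ ≤ i * j
0≤-* {+ m} {+ n} _ _ = subst (0ℤ ≤_) (pos-* m n) (+≤+ z≤n)

0≤i*i : ∀ i → 0ℤ ≤ i * i
0≤i*i (+ n)    = subst (0ℤ ≤_) (pos-* n n) (+≤+ z≤n)
0≤i*i -[1+ n ] = +≤+ z≤n

-i*-i≡i*i : ∀ i → - i * - i ≡ i * i
-i*-i≡i*i = solve-∀

≤-by-difference : ∀ {i j e} → 0ℤ ≤ e → e ≡ j - i → i ≤ j
≤-by-difference 0≤e refl = 0≤i-j⇒j≤i 0≤e

0<j-i : ∀ {i j} → i < j → 0ℤ < j - i
0<j-i {i} {j} i<j = subst (_< j - i) (+-inverseʳ i) (+-monoˡ-< (- i) i<j)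

i*i≤j*j : ∀ {i j} → 0ℤ ≤ i → i ≤ j → i * i ≤ j * j
i*i≤j*j {i} {j} 0≤i i≤j =
  ≤-trans (*-monoˡ-≤-nonNeg i {{nonNegative 0≤i}} i≤j)
          (*-monoʳ-≤-nonNeg j {{nonNegative (≤-trans 0≤i i≤j)}} i≤j)

i*i<j*j : ∀ {i j} → 0ℤ ≤ i → i < j → i * i < j * j
i*i<j*j {i} {j} 0≤i i<j =
  ≤-<-trans (*-monoˡ-≤-nonNeg i {{nonNegative 0≤i}} (<⇒≤ i<j))
            (*-monoʳ-<-pos j {{positive (≤-<-trans 0≤i i<j)}} i<j)

i*i≤j*j⇒i≤j : ∀ {i j} → 0ℤ ≤ j → i * i ≤ j * j → i ≤ j
i*i≤j*j⇒i≤j {i} {j} 0≤j i²≤j² with i ≤? j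
... | yes i≤j = i≤j
... | no  i≰j = contradiction i²≤j² (<⇒≱ (i*i<j*j 0≤j (≰⇒> i≰j)))

i+j<0⇒i<-j : ∀ {i j} → i + j < 0ℤ → i < - j
i+j<0⇒i<-j {i} {j} i+j<0 = subst₂ _<_ i+j-j≡i (+-identityˡ (- j)) (+-monoˡ-< (- j) i+j<0)
  where
  i+j-j≡i : i + j + - j ≡ i
  i+j-j≡i = solve (i ∷ j ∷ [])

i*i≤0⇒i≡0 : ∀ {i} → i * i ≤ 0ℤ → i ≡ 0ℤ
i*i≤0⇒i≡0 {i} i²≤0 with i*j≡0⇒i≡0∨j≡0 i (≤-antisym i²≤0 (0≤i*i i))
... | inj₁ i≡0 = i≡0
... | inj₂ i≡0 = i≡0

0≤m*i⇒0≤i : ∀ m .{{_ : Positive m}} {i} → 0ℤ ≤ m * i → 0ℤ ≤ i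
0≤m*i⇒0≤i m {i} 0≤mi = *-cancelˡ-≤-pos 0ℤ i m (subst (_≤ m * i) (sym (*-zeroʳ m)) 0≤mi)

m*[m*i]≤m*[m*j]⇒i≤j : ∀ m .{{_ : Positive m}} {i j} → m * (m * i) ≤ m * (m * j) → i ≤ j
m*[m*i]≤m*[m*j]⇒i≤j m {i} {j} h = *-cancelˡ-≤-pos i j m (*-cancelˡ-≤-pos (m * i) (m * j) m h)

0≰i⇒0≤-i : ∀ {i} → ¬ 0ℤ ≤ i → 0ℤ ≤ - i
0≰i⇒0≤-i 0≰i = <⇒≤ (neg-mono-< (≰⇒> 0≰i))

module SqrtOrder (k : ℤ) (0≤k : 0ℤ ≤ k) where

  infix 4 √k∣_∣≤_ ∣_∣≤√k_

  record √k∣_∣≤_ (b a : ℤ) : Set where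
    constructor _,_
    field
      0≤a    : 0ℤ ≤ a
      kb²≤a² : k * (b * b) ≤ a * a

  record ∣_∣≤√k_ (a b : ℤ) : Set where
    constructor _,_
    field
      0≤b    : 0ℤ ≤ b
      a²≤kb² : a * a ≤ k * (b * b)

  -- a + b√k ≥ 0: one of the two parts is nonnegative and dominates the other in absolute value.
  NonNeg√k : ℤ → ℤ → Set
  NonNeg√k a b = √k∣ b ∣≤ a ⊎ ∣ a ∣≤√k b

  nonNeg√k-of-0≤ : ∀ {a b} → 0ℤ ≤ a → 0ℤ ≤ b → NonNeg√k a b
  nonNeg√k-of-0≤ {a} {b} 0≤a 0≤b with ≤-total (k * (b * b)) (a * a)
  ... | inj₁ kb²≤a² = inj₁ (0≤a , kb²≤a²)
  ... | inj₂ a²≤kb² = inj₂ (0≤b , a²≤kb²)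

  √k∣∣≤-neg : ∀ {a b} → √k∣ b ∣≤ a → √k∣ - b ∣≤ a
  √k∣∣≤-neg {b = b} (0≤a , kb²≤a²) = 0≤a , subst (λ t → k * t ≤ _) (sym (-i*-i≡i*i b)) kb²≤a²

  ∣∣≤√k-neg : ∀ {a b} → ∣ a ∣≤√k b → ∣ - a ∣≤√k b
  ∣∣≤√k-neg {a} (0≤b , a²≤kb²) = 0≤b , subst (_≤ _) (sym (-i*-i≡i*i a)) a²≤kb²

  -- (k b d)² − (a c)² = k b² (k d² − c²) + c² (k b² − a²)
  ∣∣≤√k-cross : ∀ {a b c d} → ∣ a ∣≤√k b → ∣ c ∣≤√k d → a * c ≤ k * (b * d)
  ∣∣≤√k-cross {a} {b} {c} {d} (0≤b , a²≤kb²) (0≤d , c²≤kd²) =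
    i*i≤j*j⇒i≤j (0≤-* 0≤k (0≤-* 0≤b 0≤d))
      (≤-by-difference (+-mono-≤ (0≤-* (0≤-* 0≤k (0≤i*i b)) (i≤j⇒0≤j-i c²≤kd²))
                                  (0≤-* (0≤i*i c) (i≤j⇒0≤j-i a²≤kb²)))
                       (solve (a ∷ b ∷ c ∷ d ∷ k ∷ [])))

  ∣∣≤√k-gap : ∀ {a b c d} → ∣ a ∣≤√k b → ∣ c ∣≤√k d →
              k * (b * b) - a * a ≤ k * ((b + d) * (b + d)) - (a + c) * (a + c)
  ∣∣≤√k-gap {a} {b} {c} {d} x y@(_ , c²≤kd²) =
    ≤-by-difference (+-mono-≤ (i≤j⇒0≤j-i c²≤kd²) (+-mono-≤ ac≤kbd ac≤kbd))
                    (solve (a ∷ b ∷ c ∷ d ∷ k ∷ []))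
    where ac≤kbd = i≤j⇒0≤j-i (∣∣≤√k-cross x y)

  -- (a c)² − (k b d)² = a² (c² − k d²) + k d² (a² − k b²)
  √k∣∣≤-cross : ∀ {a b c d} → √k∣ b ∣≤ a → √k∣ d ∣≤ c → k * (b * d) ≤ a * c
  √k∣∣≤-cross {a} {b} {c} {d} (0≤a , kb²≤a²) (0≤c , kd²≤c²) =
    i*i≤j*j⇒i≤j (0≤-* 0≤a 0≤c)
      (≤-by-difference (+-mono-≤ (0≤-* (0≤i*i a) (i≤j⇒0≤j-i kd²≤c²))
                                  (0≤-* (0≤-* 0≤k (0≤i*i d)) (i≤j⇒0≤j-i kb²≤a²)))
                       (solve (a ∷ b ∷ c ∷ d ∷ k ∷ [])))

  √k∣∣≤-gap : ∀ {a b c d} → √k∣ b ∣≤ a → √k∣ d ∣≤ c →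
              a * a - k * (b * b) ≤ (a + c) * (a + c) - k * ((b + d) * (b + d))
  √k∣∣≤-gap {a} {b} {c} {d} x y@(_ , kd²≤c²) =
    ≤-by-difference (+-mono-≤ (i≤j⇒0≤j-i kd²≤c²) (+-mono-≤ kbd≤ac kbd≤ac))
                    (solve (a ∷ b ∷ c ∷ d ∷ k ∷ []))
    where kbd≤ac = i≤j⇒0≤j-i (√k∣∣≤-cross x y)

  ∣∣≤√k-+ : ∀ {a b c d} → ∣ a ∣≤√k b → ∣ c ∣≤√k d → ∣ a + c ∣≤√k b + d
  ∣∣≤√k-+ x@(0≤b , a²≤kb²) y@(0≤d , _) =
    +-mono-≤ 0≤b 0≤d , 0≤i-j⇒j≤i (≤-trans (i≤j⇒0≤j-i a²≤kb²) (∣∣≤√k-gap x y))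

  √k∣∣≤-+ : ∀ {a b c d} → √k∣ b ∣≤ a → √k∣ d ∣≤ c → √k∣ b + d ∣≤ a + c
  √k∣∣≤-+ x@(0≤a , kb²≤a²) y@(0≤c , _) =
    +-mono-≤ 0≤a 0≤c , 0≤i-j⇒j≤i (≤-trans (i≤j⇒0≤j-i kb²≤a²) (√k∣∣≤-gap x y))

  ∣∣<√k-+ : ∀ {a b c d} → 0ℤ ≤ b → a * a < k * (b * b) → ∣ c ∣≤√k d →
            0ℤ < k * ((b + d) * (b + d)) - (a + c) * (a + c)
  ∣∣<√k-+ {a} {b} 0≤b a²<kb² y = <-≤-trans (0<j-i a²<kb²) (∣∣≤√k-gap {a} {b} (0≤b , <⇒≤ a²<kb²) y)

  √k∣∣<-+ : ∀ {a b c d} → 0ℤ ≤ a → k * (b * b) < a * a → √k∣ d ∣≤ c →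
            0ℤ < (a + c) * (a + c) - k * ((b + d) * (b + d))
  √k∣∣<-+ {a} {b} 0≤a kb²<a² y = <-≤-trans (0<j-i kb²<a²) (√k∣∣≤-gap {a} {b} (0≤a , <⇒≤ kb²<a²) y)

  -- If a part of the sum were negative and too small, adding back the summand that dominates in
  -- the other part would produce a strict inequality contradicting one of the hypotheses.
  nonNeg√k-+-mixed : ∀ {a b c d} → √k∣ b ∣≤ a → ∣ c ∣≤√k d → NonNeg√k (a + c) (b + d)
  nonNeg√k-+-mixed {a} {b} {c} {d} x@(0≤a , kb²≤a²) y@(0≤d , c²≤kd²) with 0ℤ ≤? a + c | 0ℤ ≤? b + d
  ... | yes 0≤a+c | yes 0≤b+d = nonNeg√k-of-0≤ 0≤a+c 0≤b+d
  ... | yes 0≤a+c | no  b+d≱0 = inj₁ (0≤a+c , ≮⇒≥ λ [a+c]²<k[b+d]² →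
        <-irrefl refl (<-≤-trans
          (subst (0ℤ <_) identity
            (∣∣<√k-+ {a + c} { - (b + d)} (0≰i⇒0≤-i b+d≱0)
                     (subst (λ t → _ < k * t) (sym (-i*-i≡i*i (b + d))) [a+c]²<k[b+d]²) (∣∣≤√k-neg y)))
          (i≤j⇒i-j≤0 kb²≤a²)))
    where
    identity : k * ((- (b + d) + d) * (- (b + d) + d)) - (a + c + - c) * (a + c + - c)
               ≡ k * (b * b) - a * a
    identity = solve (a ∷ b ∷ c ∷ d ∷ k ∷ [])
  ... | no  a+c≱0 | yes 0≤b+d = inj₂ (0≤b+d , ≮⇒≥ λ k[b+d]²<[a+c]² →
        <-irrefl refl (<-≤-trans
          (subst (0ℤ <_) identity
            (√k∣∣<-+ { - (a + c)} {b + d} (0≰i⇒0≤-i a+c≱0)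
                     (subst (_ <_) (sym (-i*-i≡i*i (a + c))) k[b+d]²<[a+c]²) (√k∣∣≤-neg x)))
          (i≤j⇒i-j≤0 c²≤kd²)))
    where
    identity : (- (a + c) + a) * (- (a + c) + a) - k * ((b + d + - b) * (b + d + - b))
               ≡ c * c - k * (d * d)
    identity = solve (a ∷ b ∷ c ∷ d ∷ k ∷ [])
  ... | no  a+c≱0 | no  b+d≱0 =
        contradiction (<-≤-trans a²<c² (≤-trans c²≤kd² (≤-trans kd²≤kb² kb²≤a²))) (<-irrefl refl)
    where
    a²<c² : a * a < c * c
    a²<c² = subst (_ <_) (-i*-i≡i*i c) (i*i<j*j 0≤a (i+j<0⇒i<-j (≰⇒> a+c≱0)))
    d<-b : d < - b
    d<-b = i+j<0⇒i<-j (subst (_< 0ℤ) (+-comm b d) (≰⇒> b+d≱0))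
    kd²≤kb² : k * (d * d) ≤ k * (b * b)
    kd²≤kb² = *-monoˡ-≤-nonNeg k {{nonNegative 0≤k}} (subst (_ ≤_) (-i*-i≡i*i b) (i*i≤j*j 0≤d (<⇒≤ d<-b)))

  nonNeg√k-+ : ∀ {a b c d} → NonNeg√k a b → NonNeg√k c d → NonNeg√k (a + c) (b + d)
  nonNeg√k-+         (inj₁ x) (inj₁ y) = inj₁ (√k∣∣≤-+ x y)
  nonNeg√k-+         (inj₂ x) (inj₂ y) = inj₂ (∣∣≤√k-+ x y)
  nonNeg√k-+         (inj₁ x) (inj₂ y) = nonNeg√k-+-mixed x y
  nonNeg√k-+ {a} {b} {c} {d} (inj₂ x) (inj₁ y) =
    subst₂ NonNeg√k (+-comm c a) (+-comm d b) (nonNeg√k-+-mixed y x)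

  nonNeg√k-square : ∀ p q → NonNeg√k (p * p + k * (q * q)) (+ 2 * (p * q))
  nonNeg√k-square p q =
    inj₁ (+-mono-≤ (0≤i*i p) (0≤-* 0≤k (0≤i*i q)) ,
          ≤-by-difference (0≤i*i (p * p - k * (q * q))) (solve (p ∷ q ∷ k ∷ [])))

  nonNeg√k-rational : ∀ {a} → NonNeg√k a 0ℤ → 0ℤ ≤ a
  nonNeg√k-rational (inj₁ (0≤a , _))   = 0≤a
  nonNeg√k-rational (inj₂ (_ , a²≤k0)) = ≤-reflexive (sym (i*i≤0⇒i≡0 (subst (_ ≤_) (*-zeroʳ k) a²≤k0)))

  private
    [mi]²≡m[m[i²]] : ∀ m i → (m * i) * (m * i) ≡ m * (m * (i * i))
    [mi]²≡m[m[i²]] m i = solve (m ∷ i ∷ [])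

    k[mi]²≡m[m[ki²]] : ∀ m i → k * ((m * i) * (m * i)) ≡ m * (m * (k * (i * i)))
    k[mi]²≡m[m[ki²]] m i = solve (m ∷ i ∷ k ∷ [])

  nonNeg√k-*-cancel : ∀ m .{{_ : Positive m}} {a b} → NonNeg√k (m * a) (m * b) → NonNeg√k a b
  nonNeg√k-*-cancel m {a} {b} (inj₁ (0≤ma , k[mb]²≤[ma]²)) =
    inj₁ (0≤m*i⇒0≤i m 0≤ma ,
          m*[m*i]≤m*[m*j]⇒i≤j m (subst₂ _≤_ (k[mi]²≡m[m[ki²]] m b) ([mi]²≡m[m[i²]] m a) k[mb]²≤[ma]²))
  nonNeg√k-*-cancel m {a} {b} (inj₂ (0≤mb , [ma]²≤k[mb]²)) =
    inj₂ (0≤m*i⇒0≤i m 0≤mb ,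
          m*[m*i]≤m*[m*j]⇒i≤j m (subst₂ _≤_ ([mi]²≡m[m[i²]] m a) (k[mi]²≡m[m[ki²]] m b) [ma]²≤k[mb]²))

open SqrtOrder (+ 5) (+≤+ z≤n)

infix 4 _≟ζ_

zeroζ : Zζ
zeroζ = ⟨ 0ℤ , 0ℤ , 0ℤ , 0ℤ ⟩

Zζ-≡ : ∀ {a0 a1 a2 a3 b0 b1 b2 b3} → a0 ≡ b0 → a1 ≡ b1 → a2 ≡ b2 → a3 ≡ b3 →
       ⟨ a0 , a1 , a2 , a3 ⟩ ≡ ⟨ b0 , b1 , b2 , b3 ⟩
Zζ-≡ refl refl refl refl = refl

_≟ζ_ : DecidableEquality Zζ
⟨ a0 , a1 , a2 , a3 ⟩ ≟ζ ⟨ b0 , b1 , b2 , b3 ⟩ =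
  map′ (λ { (refl , refl , refl , refl) → refl }) (λ { refl → refl , refl , refl , refl })
       (a0 ≟ b0 ×-dec a1 ≟ b1 ×-dec a2 ≟ b2 ×-dec a3 ≟ b3)

x-ζy≡0⇒x≡y : ∀ x y → x -ζ y ≡ zeroζ → x ≡ y
x-ζy≡0⇒x≡y ⟨ a0 , a1 , a2 , a3 ⟩ ⟨ b0 , b1 , b2 , b3 ⟩ x-y≡0 =
  Zζ-≡ (i-j≡0⇒i≡j a0 b0 (cong Zζ.c0 x-y≡0)) (i-j≡0⇒i≡j a1 b1 (cong Zζ.c1 x-y≡0))
       (i-j≡0⇒i≡j a2 b2 (cong Zζ.c2 x-y≡0)) (i-j≡0⇒i≡j a3 b3 (cong Zζ.c3 x-y≡0))

-- 4|z|² = ra-fourAbsSq + rb-fourAbsSq · √5 for z = a0 + a1 ζ + a2 ζ² + a3 ζ³, because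
-- 4 cos 72° = √5 − 1 and 4 cos 144° = −√5 − 1. INLINE lets the ring solver see the polynomials.
ra-fourAbsSq : ℤ → ℤ → ℤ → ℤ → ℤ
ra-fourAbsSq a0 a1 a2 a3 =
  + 4 * (a0 * a0 + a1 * a1 + a2 * a2 + a3 * a3)
    - + 2 * (a0 * a1 + a0 * a2 + a0 * a3 + a1 * a2 + a1 * a3 + a2 * a3)
{-# INLINE ra-fourAbsSq #-}

rb-fourAbsSq : ℤ → ℤ → ℤ → ℤ → ℤ
rb-fourAbsSq a0 a1 a2 a3 = + 2 * (a0 * a1 + a1 * a2 + a2 * a3 - a0 * a2 - a1 * a3 - a0 * a3)
{-# INLINE rb-fourAbsSq #-}

QS-≡ : ∀ {x y} → QS.ra x ≡ QS.ra y → QS.rb x ≡ QS.rb y → x ≡ y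
QS-≡ refl refl = refl

fourAbsSq-≡ : ∀ a0 a1 a2 a3 →
              fourAbsSq ⟨ a0 , a1 , a2 , a3 ⟩ ≡ ra-fourAbsSq a0 a1 a2 a3 +√5· rb-fourAbsSq a0 a1 a2 a3
fourAbsSq-≡ a0 a1 a2 a3 = QS-≡ (ra-≡ a0 a1 a2 a3) (rb-≡ a0 a1 a2 a3)
  where
  -- fourAbsSq ⟨ a0 , a1 , a2 , a3 ⟩ unfolded: b is conj z, d the product z *ζ b before reduction by red5.
  ra-≡ : ∀ a0 a1 a2 a3 →
    let b0 = a0 - a1
        b1 = 0ℤ - a1
        b2 = a3 - a1
        b3 = a2 - a1
        d0 = a0 * b0 + (a2 * b3 + a3 * b2)
        d1 = a0 * b1 + a1 * b0 + a3 * b3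
        d2 = a0 * b2 + a1 * b1 + a2 * b0
        d3 = a0 * b3 + a1 * b2 + a2 * b1 + a3 * b0
        d4 = a1 * b3 + a2 * b2 + a3 * b1
    in + 4 * (d0 - d4) - (d1 - d4) - (d2 - d4) - (d3 - d4) ≡ ra-fourAbsSq a0 a1 a2 a3
  ra-≡ = solve-∀
  rb-≡ : ∀ a0 a1 a2 a3 →
    let b0 = a0 - a1
        b1 = 0ℤ - a1
        b2 = a3 - a1
        b3 = a2 - a1
        d1 = a0 * b1 + a1 * b0 + a3 * b3
        d2 = a0 * b2 + a1 * b1 + a2 * b0
        d3 = a0 * b3 + a1 * b2 + a2 * b1 + a3 * b0
        d4 = a1 * b3 + a2 * b2 + a3 * b1
    in (d1 - d4) - (d2 - d4) - (d3 - d4) ≡ rb-fourAbsSq a0 a1 a2 a3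
  rb-≡ = solve-∀

-- 16|z|² = (4 Re z)² + (4 Im z)², where 4 Re z = fourRe z and
-- (4 Im z)² = 10 (c² + d²) + (2c² + 8cd − 2d²) √5 for c = a1, d = a2 − a3.
fourAbsSq-nonNeg√5 : ∀ a0 a1 a2 a3 → NonNeg√k (ra-fourAbsSq a0 a1 a2 a3) (rb-fourAbsSq a0 a1 a2 a3)
fourAbsSq-nonNeg√5 a0 a1 a2 a3 =
  nonNeg√k-*-cancel (+ 4) (subst₂ NonNeg√k (ra-identity a0 a1 a2 a3) (rb-identity a0 a1 a2 a3)
    (nonNeg√k-+ (nonNeg√k-square (+ 4 * a0 - a1 - a2 - a3) (a1 - a2 - a3)) (imaginarySquare a1 (a2 - a3))))
  where
  imaginarySquare : ∀ c d → NonNeg√k (+ 10 * (c * c + d * d)) (+ 2 * (c * c) + + 8 * (c * d) - + 2 * (d * d))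
  imaginarySquare c d =
    inj₁ (0≤-* {+ 10} (+≤+ z≤n) (+-mono-≤ (0≤i*i c) (0≤i*i d)) ,
          ≤-by-difference (0≤-* {+ 80} (+≤+ z≤n) (0≤i*i (c * c - d * d - c * d))) (solve (c ∷ d ∷ [])))
  ra-identity : ∀ a0 a1 a2 a3 →
    (+ 4 * a0 - a1 - a2 - a3) * (+ 4 * a0 - a1 - a2 - a3) + + 5 * ((a1 - a2 - a3) * (a1 - a2 - a3))
      + + 10 * (a1 * a1 + (a2 - a3) * (a2 - a3))
    ≡ + 4 * ra-fourAbsSq a0 a1 a2 a3
  ra-identity = solve-∀
  rb-identity : ∀ a0 a1 a2 a3 →
    + 2 * ((+ 4 * a0 - a1 - a2 - a3) * (a1 - a2 - a3))
      + (+ 2 * (a1 * a1) + + 8 * (a1 * (a2 - a3)) - + 2 * ((a2 - a3) * (a2 - a3)))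
    ≡ + 4 * rb-fourAbsSq a0 a1 a2 a3
  rb-identity = solve-∀

parallelogram-nonNeg√5 : ∀ u0 u1 u2 u3 v0 v1 v2 v3 →
  NonNeg√k (+ 4 - ra-fourAbsSq u0 u1 u2 u3) (- rb-fourAbsSq u0 u1 u2 u3) →
  NonNeg√k (+ 4 - ra-fourAbsSq v0 v1 v2 v3) (- rb-fourAbsSq v0 v1 v2 v3) →
  NonNeg√k (+ 16 - ra-fourAbsSq (u0 - v0) (u1 - v1) (u2 - v2) (u3 - v3))
           (- rb-fourAbsSq (u0 - v0) (u1 - v1) (u2 - v2) (u3 - v3))
parallelogram-nonNeg√5 u0 u1 u2 u3 v0 v1 v2 v3 |u|≤1 |v|≤1 =
  subst₂ NonNeg√k (ra-law u0 u1 u2 u3 v0 v1 v2 v3) (rb-law u0 u1 u2 u3 v0 v1 v2 v3)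
    (nonNeg√k-+ (nonNeg√k-+ (nonNeg√k-+ (nonNeg√k-+ |u|≤1 |u|≤1) |v|≤1) |v|≤1)
                (fourAbsSq-nonNeg√5 (u0 + v0) (u1 + v1) (u2 + v2) (u3 + v3)))
  where
  ra-law : ∀ u0 u1 u2 u3 v0 v1 v2 v3 →
    (+ 4 - ra-fourAbsSq u0 u1 u2 u3) + (+ 4 - ra-fourAbsSq u0 u1 u2 u3)
      + (+ 4 - ra-fourAbsSq v0 v1 v2 v3) + (+ 4 - ra-fourAbsSq v0 v1 v2 v3)
      + ra-fourAbsSq (u0 + v0) (u1 + v1) (u2 + v2) (u3 + v3)
    ≡ + 16 - ra-fourAbsSq (u0 - v0) (u1 - v1) (u2 - v2) (u3 - v3)
  ra-law = solve-∀
  rb-law : ∀ u0 u1 u2 u3 v0 v1 v2 v3 →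
    - rb-fourAbsSq u0 u1 u2 u3 + - rb-fourAbsSq u0 u1 u2 u3
      + - rb-fourAbsSq v0 v1 v2 v3 + - rb-fourAbsSq v0 v1 v2 v3
      + rb-fourAbsSq (u0 + v0) (u1 + v1) (u2 + v2) (u3 + v3)
    ≡ - rb-fourAbsSq (u0 - v0) (u1 - v1) (u2 - v2) (u3 - v3)
  rb-law = solve-∀

_≥0 : QS → Set
x ≥0 = NonNeg√k (QS.ra x) (QS.rb x)

Pos⇒≥0 : ∀ x → Pos x → x ≥0
Pos⇒≥0 (a +√5· b) (inj₁ (0<a , 0≤b))                     = nonNeg√k-of-0≤ (<⇒≤ 0<a) 0≤b
Pos⇒≥0 (a +√5· b) (inj₂ (inj₁ (0≤a , 0<b)))              = nonNeg√k-of-0≤ 0≤a (<⇒≤ 0<b)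
Pos⇒≥0 (a +√5· b) (inj₂ (inj₂ (inj₁ (0<a , _ , 5b²<a²)))) = inj₁ (<⇒≤ 0<a , <⇒≤ 5b²<a²)
Pos⇒≥0 (a +√5· b) (inj₂ (inj₂ (inj₂ (_ , 0<b , a²<5b²)))) = inj₂ (<⇒≤ 0<b , <⇒≤ a²<5b²)

NonNeg⇒≥0 : ∀ x → NonNeg x → x ≥0
NonNeg⇒≥0 x              (inj₁ x>0)           = Pos⇒≥0 x x>0
NonNeg⇒≥0 (.0ℤ +√5· .0ℤ) (inj₂ (refl , refl)) = nonNeg√k-of-0≤ ≤-refl ≤-refl

⊖-fourAbsSq-≥0⇒ : ∀ c a0 a1 a2 a3 →
                  (c ⊖ fourAbsSq ⟨ a0 , a1 , a2 , a3 ⟩) ≥0 →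
                  NonNeg√k (c - ra-fourAbsSq a0 a1 a2 a3) (- rb-fourAbsSq a0 a1 a2 a3)
⊖-fourAbsSq-≥0⇒ c a0 a1 a2 a3 = subst (λ x → (c ⊖ x) ≥0) (fourAbsSq-≡ a0 a1 a2 a3)

⊖-fourAbsSq-≥0⇐ : ∀ c a0 a1 a2 a3 →
                  NonNeg√k (c - ra-fourAbsSq a0 a1 a2 a3) (- rb-fourAbsSq a0 a1 a2 a3) →
                  (c ⊖ fourAbsSq ⟨ a0 , a1 , a2 , a3 ⟩) ≥0
⊖-fourAbsSq-≥0⇐ c a0 a1 a2 a3 = subst (λ x → (c ⊖ x) ≥0) (sym (fourAbsSq-≡ a0 a1 a2 a3))

disc-difference : ∀ u v → ((+ 4) ⊖ fourAbsSq u) ≥0 → ((+ 4) ⊖ fourAbsSq v) ≥0 →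
                  ((+ 16) ⊖ fourAbsSq (u -ζ v)) ≥0
disc-difference ⟨ u0 , u1 , u2 , u3 ⟩ ⟨ v0 , v1 , v2 , v3 ⟩ |u|≤1 |v|≤1 =
  ⊖-fourAbsSq-≥0⇐ (+ 16) (u0 - v0) (u1 - v1) (u2 - v2) (u3 - v3)
    (parallelogram-nonNeg√5 u0 u1 u2 u3 v0 v1 v2 v3 (⊖-fourAbsSq-≥0⇒ (+ 4) u0 u1 u2 u3 |u|≤1)
                                                    (⊖-fourAbsSq-≥0⇒ (+ 4) v0 v1 v2 v3 |v|≤1))

[i-j]-[k-l]≡[i-k]-[j-l] : ∀ i j k l → (i - j) - (k - l) ≡ (i - k) - (j - l)
[i-j]-[k-l]≡[i-k]-[j-l] = solve-∀

σ-distrib--ζ : ∀ x y → σ (x -ζ y) ≡ σ x -ζ σ y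
σ-distrib--ζ ⟨ x0 , x1 , x2 , x3 ⟩ ⟨ y0 , y1 , y2 , y3 ⟩ =
  Zζ-≡ ([i-j]-[k-l]≡[i-k]-[j-l] x0 y0 x2 y2) ([i-j]-[k-l]≡[i-k]-[j-l] x3 y3 x2 y2)
       ([i-j]-[k-l]≡[i-k]-[j-l] x1 y1 x2 y2) ([i-j]-[k-l]≡[i-k]-[j-l] 0ℤ 0ℤ x2 y2)

σ-difference-bound : ∀ z₁ z₂ → InS z₁ → InS z₂ → ((+ 16) ⊖ fourAbsSq (σ (z₁ -ζ z₂))) ≥0
σ-difference-bound z₁ z₂ z₁∈𝒮 z₂∈𝒮 =
  subst (λ u → ((+ 16) ⊖ fourAbsSq u) ≥0) (sym (σ-distrib--ζ z₁ z₂))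
    (disc-difference (σ z₁) (σ z₂) (NonNeg⇒≥0 _ z₁∈𝒮) (NonNeg⇒≥0 _ z₂∈𝒮))

0≤21-2i⇒i≤10 : ∀ i → 0ℤ ≤ + 21 - + 2 * i → i ≤ + 10
0≤21-2i⇒i≤10 i 0≤21-2i = ≮⇒≥ λ 10<i →
  from-no (+ 22 ≤? + 21) (≤-trans (*-monoˡ-≤-nonNeg (+ 2) (i<j⇒suc[i]≤j 10<i)) (0≤i-j⇒j≤i 0≤21-2i))

-- σ restricts to √5 ↦ −√5 on ℚ(√5) = ℚ(ζ + ζ⁻¹), so 4|σ w|² is 4|w|² with its irrational part negated.
ra-fourAbsSq-≤-10 : ∀ w → AbsLtHalfSqrt5 w → ((+ 16) ⊖ fourAbsSq (σ w)) ≥0 → QS.ra (fourAbsSq w) ≤ + 10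
ra-fourAbsSq-≤-10 ⟨ a0 , a1 , a2 , a3 ⟩ |w|<√5/2 |σw|≤2 =
  subst (_≤ + 10) (sym (cong QS.ra (fourAbsSq-≡ a0 a1 a2 a3)))
    (0≤21-2i⇒i≤10 (ra-fourAbsSq a0 a1 a2 a3)
      (nonNeg√k-rational (subst₂ NonNeg√k (ra-galois a0 a1 a2 a3) (rb-galois a0 a1 a2 a3)
        (nonNeg√k-+ (⊖-fourAbsSq-≥0⇒ (+ 5) a0 a1 a2 a3 (Pos⇒≥0 _ |w|<√5/2))
                    (⊖-fourAbsSq-≥0⇒ (+ 16) (a0 - a2) (a3 - a2) (a1 - a2) (0ℤ - a2) |σw|≤2)))))
  where
  ra-galois : ∀ a0 a1 a2 a3 →
    + 5 - ra-fourAbsSq a0 a1 a2 a3 + (+ 16 - ra-fourAbsSq (a0 - a2) (a3 - a2) (a1 - a2) (0ℤ - a2))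
    ≡ + 21 - + 2 * ra-fourAbsSq a0 a1 a2 a3
  ra-galois = solve-∀
  rb-galois : ∀ a0 a1 a2 a3 →
    - rb-fourAbsSq a0 a1 a2 a3 + - rb-fourAbsSq (a0 - a2) (a3 - a2) (a1 - a2) (0ℤ - a2) ≡ 0ℤ
  rb-galois = solve-∀

sumOfSquares : List ℤ → ℤ
sumOfSquares []       = 0ℤ
sumOfSquares (x ∷ xs) = x * x + sumOfSquares xs

0≤sumOfSquares : ∀ xs → 0ℤ ≤ sumOfSquares xs
0≤sumOfSquares []       = ≤-refl
0≤sumOfSquares (x ∷ xs) = +-mono-≤ (0≤i*i x) (0≤sumOfSquares xs)

square-≤-sumOfSquares : ∀ {x xs} → x ∈ xs → x * x ≤ sumOfSquares xs
square-≤-sumOfSquares {x} {_ ∷ xs} (here refl) =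
  i≤i+j (x * x) (sumOfSquares xs) {{nonNegative (0≤sumOfSquares xs)}}
square-≤-sumOfSquares {x} {y ∷ xs} (there x∈xs) =
  ≤-trans (square-≤-sumOfSquares x∈xs) (i≤j+i (sumOfSquares xs) (y * y) {{nonNegative (0≤i*i y)}})

coefficientsAndDifferences : ℤ → ℤ → ℤ → ℤ → List ℤ
coefficientsAndDifferences a0 a1 a2 a3 =
  a0 ∷ a1 ∷ a2 ∷ a3 ∷ a0 - a1 ∷ a0 - a2 ∷ a0 - a3 ∷ a1 - a2 ∷ a1 - a3 ∷ a2 - a3 ∷ []

ra-fourAbsSq-sumOfSquares : ∀ a0 a1 a2 a3 →
                            ra-fourAbsSq a0 a1 a2 a3 ≡ sumOfSquares (coefficientsAndDifferences a0 a1 a2 a3)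
ra-fourAbsSq-sumOfSquares a0 a1 a2 a3 = expanded a0 a1 a2 a3
  where
  expanded : ∀ a0 a1 a2 a3 → ra-fourAbsSq a0 a1 a2 a3 ≡
    a0 * a0 + (a1 * a1 + (a2 * a2 + (a3 * a3 + ((a0 - a1) * (a0 - a1) + ((a0 - a2) * (a0 - a2)
      + ((a0 - a3) * (a0 - a3) + ((a1 - a2) * (a1 - a2) + ((a1 - a3) * (a1 - a3)
      + ((a2 - a3) * (a2 - a3) + 0ℤ)))))))))
  expanded = solve-∀

coefficientRange : List ℤ
coefficientRange = - + 3 ∷ - + 2 ∷ - + 1 ∷ + 0 ∷ + 1 ∷ + 2 ∷ + 3 ∷ []

square-of-large : ∀ n → ¬ (+[1+ suc (suc (suc n)) ] * +[1+ suc (suc (suc n)) ] ≤ + 10)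
square-of-large n a²≤10 =
  from-no (+ 16 ≤? + 10) (≤-trans (i*i≤j*j {+ 4} (+≤+ z≤n) (+≤+ (s≤s (s≤s (s≤s (s≤s z≤n)))))) a²≤10)

∈-coefficientRange : ∀ a → a * a ≤ + 10 → a ∈ coefficientRange
∈-coefficientRange -[1+ 2 ] _ = here refl
∈-coefficientRange -[1+ 1 ] _ = there (here refl)
∈-coefficientRange -[1+ 0 ] _ = there (there (here refl))
∈-coefficientRange (+ 0)    _ = there (there (there (here refl)))
∈-coefficientRange (+ 1)    _ = there (there (there (there (here refl))))
∈-coefficientRange (+ 2)    _ = there (there (there (there (there (here refl)))))
∈-coefficientRange (+ 3)    _ = there (there (there (there (there (there (here refl))))))
∈-coefficientRange +[1+ suc (suc (suc n)) ] a²≤10 = contradiction a²≤10 (square-of-large n)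
∈-coefficientRange a@(-[1+ suc (suc (suc n)) ]) a²≤10 =
  contradiction (subst (_≤ + 10) (sym (-i*-i≡i*i a)) a²≤10) (square-of-large n)

fromPairs : ℤ × ℤ → ℤ × ℤ → Zζ
fromPairs (a0 , a1) (a2 , a3) = ⟨ a0 , a1 , a2 , a3 ⟩

box : List Zζ
box = cartesianProductWith fromPairs (cartesianProduct coefficientRange coefficientRange)
                                     (cartesianProduct coefficientRange coefficientRange)

∈-box : ∀ w → QS.ra (fourAbsSq w) ≤ + 10 → w ∈ box
∈-box ⟨ a0 , a1 , a2 , a3 ⟩ ra≤10 =
  ∈-cartesianProductWith⁺ fromPairs (∈-cartesianProduct⁺ (inRange (here refl)) (inRange (there (here refl))))
                                    (∈-cartesianProduct⁺ (inRange (there (there (here refl))))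
                                                          (inRange (there (there (there (here refl))))))
  where
  sumOfSquares≤10 : sumOfSquares (coefficientsAndDifferences a0 a1 a2 a3) ≤ + 10
  sumOfSquares≤10 =
    subst (_≤ + 10) (trans (cong QS.ra (fourAbsSq-≡ a0 a1 a2 a3)) (ra-fourAbsSq-sumOfSquares a0 a1 a2 a3)) ra≤10
  inRange : ∀ {a} → a ∈ coefficientsAndDifferences a0 a1 a2 a3 → a ∈ coefficientRange
  inRange a∈ = ∈-coefficientRange _ (≤-trans (square-≤-sumOfSquares a∈) sumOfSquares≤10)

-- The product of the other three conjugates of w, so that w *ζ normCofactor w is the norm of w.
normCofactor : Zζ → Zζ
normCofactor w = (conj w *ζ σ w) *ζ conj (σ w)

UnitCriterion : Zζ → Set
UnitCriterion w = ¬ w ≡ zeroζ → QS.ra (fourAbsSq w) ≤ + 10 → AbsLtHalfSqrt5 w → w *ζ normCofactor w ≡ oneζ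

pos? : ∀ x → Dec (Pos x)
pos? (a +√5· b) =
        0ℤ <? a ×-dec 0ℤ ≤? b
  ⊎-dec 0ℤ ≤? a ×-dec 0ℤ <? b
  ⊎-dec 0ℤ <? a ×-dec b <? 0ℤ ×-dec + 5 * (b * b) <? a * a
  ⊎-dec a <? 0ℤ ×-dec 0ℤ <? b ×-dec a * a <? + 5 * (b * b)

unitCriterion? : ∀ w → Dec (UnitCriterion w)
unitCriterion? w =
  ¬? (w ≟ζ zeroζ) →-dec QS.ra (fourAbsSq w) ≤? + 10 →-dec pos? _ →-dec (w *ζ normCofactor w) ≟ζ oneζ

unitCriterion-box : All UnitCriterion box
unitCriterion-box = from-yes (all? unitCriterion? box)

mainTheorem4 : (z₁ z₂ : Zζ) → InS z₁ → InS z₂ → ¬ (z₁ ≡ z₂) →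
    AbsLtHalfSqrt5 (z₁ -ζ z₂) → IsUnit (z₁ -ζ z₂)
mainTheorem4 z₁ z₂ z₁∈𝒮 z₂∈𝒮 z₁≢z₂ |w|<√5/2 =
  normCofactor w , lookup unitCriterion-box (∈-box w ra≤10) (z₁≢z₂ ∘ x-ζy≡0⇒x≡y z₁ z₂) ra≤10 |w|<√5/2
  where
  w = z₁ -ζ z₂
  ra≤10 : QS.ra (fourAbsSq w) ≤ + 10
  ra≤10 = ra-fourAbsSq-≤-10 w |w|<√5/2 (σ-difference-bound z₁ z₂ z₁∈𝒮 z₂∈𝒮)
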